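{- Let $G$ and $H$ be connected graphs, each with at least $2$ vertices, neither of which has a perfect matching. If $G\Box H$ is well-edge-dominated, then both $G$ and $H$ are well-edge-dominated.
   Context: The Cartesian product $G\Box H$ has vertex set $V(G)\times V(H)$, with $(g_1,h_1)$ adjacent to $(g_2,h_2)$ iff either $g_1=g_2$ and $h_1h_2\in E(H)$, or $h_1=h_2$ and $g_1g_2\in E(G)$. A set $F$ of edges is an edge dominating set if every edge not in $F$ shares an endpoint with some edge of $F$; it is minimal if no proper subset is. A graph is well-edge-dominated if all its minimal edge dominating sets have the same cardinality. -}

module Defs where

open import Data.Nat using (ℕ; _≥_)
open import Data.Fin using (Fin)
open import Data.Product using (Σ; ∃; _×_; _,_; proj₁; proj₂)
open import Data.Sum using (_⊎_)
open import Data.List using (List; length)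
open import Data.List.Membership.Propositional using (_∈_; _∉_)
open import Data.List.Relation.Unary.All using (All)
open import Data.List.Relation.Unary.AllPairs using (AllPairs)
open import Relation.Nullary using (¬_)
open import Relation.Binary.PropositionalEquality using (_≡_)

record Graph (V : Set) : Set₁ where
  field
    Adj   : V → V → Set
    sym   : ∀ {u v} → Adj u v → Adj v u
    irrefl : ∀ {u} → ¬ Adj u u
open Graph public

_□_ : ∀ {A B : Set} → Graph A → Graph B → Graph (A × B)
Adj (_□_ G H) (g₁ , h₁) (g₂ , h₂) =
  (g₁ ≡ g₂ × Adj H h₁ h₂) ⊎ (h₁ ≡ h₂ × Adj G g₁ g₂)
sym (_□_ G H) (Data.Sum.inj₁ (Relation.Binary.PropositionalEquality.refl , a)) =
  Data.Sum.inj₁ (Relation.Binary.PropositionalEquality.refl , sym H a)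
sym (_□_ G H) (Data.Sum.inj₂ (Relation.Binary.PropositionalEquality.refl , a)) =
  Data.Sum.inj₂ (Relation.Binary.PropositionalEquality.refl , sym G a)
irrefl (_□_ G H) (Data.Sum.inj₁ (_ , a)) = irrefl H a
irrefl (_□_ G H) (Data.Sum.inj₂ (_ , a)) = irrefl G a

module _ {V : Set} (G : Graph V) where

  -- An edge {u,v} is represented by an ordered pair (u , v) with u ~ v;
  -- (u , v) and (v , u) represent the same edge.
  SameEdge : V × V → V × V → Set
  SameEdge (u , v) (x , y) = (u ≡ x × v ≡ y) ⊎ (u ≡ y × v ≡ x)

  IsEdge : V × V → Set
  IsEdge (u , v) = Adj G u v

  -- A set of edges of G: a list of edges, no edge listed twice
  -- (in either orientation).  Its cardinality is its length.
  record EdgeSet : Set where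
    constructor edgeSet
    field
      edges    : List (V × V)
      areEdges : All IsEdge edges
      distinct : AllPairs (λ e f → ¬ SameEdge e f) edges
  open EdgeSet public

  _∈E_ : V × V → EdgeSet → Set
  e ∈E F = ∃ λ f → f ∈ edges F × SameEdge e f

  Incident : V → V × V → Set
  Incident w (u , v) = w ≡ u ⊎ w ≡ v

  ShareEndpoint : V × V → V × V → Set
  ShareEndpoint (u , v) f = Incident u f ⊎ Incident v f

  IsEdgeDominating : EdgeSet → Set
  IsEdgeDominating F =
    ∀ e → IsEdge e → ¬ (e ∈E F) → ∃ λ f → f ∈ edges F × ShareEndpoint e f

  _⊆E_ : EdgeSet → EdgeSet → Set
  F ⊆E F' = ∀ e → e ∈E F → e ∈E F'

  _⊂E_ : EdgeSet → EdgeSet → Set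
  F ⊂E F' = F ⊆E F' × ∃ λ e → e ∈E F' × ¬ (e ∈E F)

  IsMinimalEdgeDominating : EdgeSet → Set
  IsMinimalEdgeDominating F =
    IsEdgeDominating F × (∀ F' → F' ⊂E F → ¬ IsEdgeDominating F')

  WellEdgeDominated : Set
  WellEdgeDominated =
    ∀ F F' → IsMinimalEdgeDominating F → IsMinimalEdgeDominating F' →
      length (edges F) ≡ length (edges F')

  data Reachable : V → V → Set where
    here : ∀ {u} → Reachable u u
    step : ∀ {u v w} → Adj G u v → Reachable v w → Reachable u w

  Connected : Set
  Connected = ∀ u v → Reachable u v

  IsPerfectMatching : EdgeSet → Set
  IsPerfectMatching M =
    AllPairs (λ e f → ∀ w → Incident w e → ¬ Incident w f) (edges M) ×
    (∀ w → ∃ λ e → e ∈ edges M × Incident w e)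

  HasPerfectMatching : Set
  HasPerfectMatching = ∃ λ M → IsPerfectMatching M

-- Fix a maximal matching M of H and let U be the set of vertices of H it leaves unmatched;
-- U is nonempty because H has no perfect matching.  For a minimal edge dominating set F
-- of G, the copies of M in all H-fibres together with the copies of F in the G-layers
-- over U form a minimal edge dominating set of G □ H of size |V(G)| |M| + |U| |F|: the
-- fibre copies of M meet no other edge of this set, and inside a layer over U the set
-- looks exactly like F.  If G □ H is well-edge-dominated, all these sizes agree, and
-- cancelling |U| > 0 shows that G is well-edge-dominated; H follows since G □ H ≅ H □ G.

module Submission where

open import Data.Empty using (⊥-elim)
open import Data.Fin using (Fin) renaming (_≟_ to _≟ᶠ_)
open import Data.Fin.Properties using (sequence)
open import Data.List
  using (List; []; _∷_; _++_; length; map; filter; foldl; allFin; cartesianProduct; cartesianProductWith)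
open import Data.List.Membership.Propositional using (_∈_; find; lose)
open import Data.List.Membership.Propositional.Properties
  using ( ∈-filter⁺; ∈-filter⁻; ∈-map⁺; ∈-map⁻; ∈-allFin; ∈-++⁺ˡ; ∈-++⁺ʳ; ∈-++⁻
        ; ∈-cartesianProduct⁺; ∈-cartesianProductWith⁺; ∈-cartesianProductWith⁻)
open import Data.List.Properties using (length-map; length-++; length-tabulate)
open import Data.List.Relation.Binary.Disjoint.Setoid using (Disjoint)
open import Data.List.Relation.Unary.All as All using (All; []; _∷_)
import Data.List.Relation.Unary.All.Properties as Allₚ
open import Data.List.Relation.Unary.AllPairs as AllPairs using (AllPairs; []; _∷_)
import Data.List.Relation.Unary.AllPairs.Properties as AllPairsₚ
open import Data.List.Relation.Unary.Any using (any?; here; there)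
open import Data.List.Relation.Unary.Unique.Propositional using (Unique)
import Data.List.Relation.Unary.Unique.Propositional.Properties as Uniqueₚ
import Data.List.Relation.Unary.Unique.Setoid as UniqueSetoid
import Data.List.Relation.Unary.Unique.Setoid.Properties as UniqueSetoidₚ
open import Data.Nat using (ℕ; _≥_; NonZero; _+_; _*_)
open import Data.Nat.Properties using (+-cancelˡ-≡; *-cancelˡ-≡) renaming (_≟_ to _≟ℕ_)
open import Data.Product using (∃; _×_; _,_; proj₁; proj₂; swap)
import Data.Product as Product
open import Data.Product.Properties using (≡-dec)
open import Data.Sum as Sum using (_⊎_; inj₁; inj₂)
open import Effect.Monad using (RawMonad)
open import Function using (_∘_; id; case_of_)
open import Level using (0ℓ)
open import Relation.Binary.Bundles using (Setoid)
open import Relation.Binary.Definitions using (DecidableEquality; Decidable)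
open import Relation.Binary.PropositionalEquality
  using (_≡_; refl; sym; cong; cong₂; subst; subst₂; setoid; module ≡-Reasoning)
open import Relation.Nullary using (¬_; Dec; yes; no)
open import Relation.Nullary.Decidable
  using (_×-dec_; _⊎-dec_; ¬?; map′; decidable-stable; ¬¬-excluded-middle)
open import Relation.Nullary.Negation using (¬¬-Monad)

open import Defs hiding (sym; here)

length-cartesianProductWith : ∀ {A B C : Set} (f : A → B → C) xs ys →
  length (cartesianProductWith f xs ys) ≡ length xs * length ys
length-cartesianProductWith f []       ys = refl
length-cartesianProductWith f (x ∷ xs) ys = begin
  length (map (f x) ys ++ cartesianProductWith f xs ys)
    ≡⟨ length-++ (map (f x) ys) ⟩
  length (map (f x) ys) + length (cartesianProductWith f xs ys)
    ≡⟨ cong₂ _+_ (length-map (f x) ys) (length-cartesianProductWith f xs ys) ⟩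
  length ys + length xs * length ys
    ∎
  where open ≡-Reasoning

module EdgeProperties {V : Set} (G : Graph V) where

  sameEdge-refl : ∀ {e} → SameEdge G e e
  sameEdge-refl = inj₁ (refl , refl)

  sameEdge-sym : ∀ {e f} → SameEdge G e f → SameEdge G f e
  sameEdge-sym (inj₁ (refl , refl)) = inj₁ (refl , refl)
  sameEdge-sym (inj₂ (refl , refl)) = inj₂ (refl , refl)

  sameEdge-trans : ∀ {e f g} → SameEdge G e f → SameEdge G f g → SameEdge G e g
  sameEdge-trans (inj₁ (refl , refl)) s                    = s
  sameEdge-trans (inj₂ (refl , refl)) (inj₁ (refl , refl)) = inj₂ (refl , refl)
  sameEdge-trans (inj₂ (refl , refl)) (inj₂ (refl , refl)) = inj₁ (refl , refl)

  edgeSetoid : Setoid 0ℓ 0ℓ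
  edgeSetoid = record
    { Carrier       = V × V
    ; _≈_           = SameEdge G
    ; isEquivalence = record { refl = sameEdge-refl ; sym = sameEdge-sym ; trans = sameEdge-trans }
    }

  sameEdge⇒share : ∀ {e f} → SameEdge G e f → ShareEndpoint G e f
  sameEdge⇒share (inj₁ (refl , refl)) = inj₁ (inj₁ refl)
  sameEdge⇒share (inj₂ (refl , refl)) = inj₁ (inj₂ refl)

  incident-resp : ∀ {w d d'} → SameEdge G d d' → Incident G w d → Incident G w d'
  incident-resp (inj₁ (refl , refl)) i        = i
  incident-resp (inj₂ (refl , refl)) (inj₁ i) = inj₂ i
  incident-resp (inj₂ (refl , refl)) (inj₂ i) = inj₁ i

  share-respʳ : ∀ {e d d'} → SameEdge G d d' → ShareEndpoint G e d → ShareEndpoint G e d'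
  share-respʳ s (inj₁ i) = inj₁ (incident-resp s i)
  share-respʳ s (inj₂ i) = inj₂ (incident-resp s i)

  ∈E-resp : ∀ (F : EdgeSet G) {e e'} → SameEdge G e' e → _∈E_ G e F → _∈E_ G e' F
  ∈E-resp F s (f , f∈ , s') = f , f∈ , sameEdge-trans s s'

  ∈⇒∈E : ∀ (F : EdgeSet G) {f} → f ∈ edges F → _∈E_ G f F
  ∈⇒∈E F f∈ = _ , f∈ , sameEdge-refl

  Dominates : EdgeSet G → Set
  Dominates F = ∀ e → IsEdge G e → ∃ λ f → f ∈ edges F × ShareEndpoint G e f

  dominates⇒dominating : ∀ F → Dominates F → IsEdgeDominating G F
  dominates⇒dominating F dom e e-edge _ = dom e e-edge

  module DecidableVertices (_≟_ : DecidableEquality V) where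

    sameEdge? : Decidable (SameEdge G)
    sameEdge? (u , v) (x , y) = ((u ≟ x) ×-dec (v ≟ y)) ⊎-dec ((u ≟ y) ×-dec (v ≟ x))

    _∈E?_ : ∀ e (F : EdgeSet G) → Dec (_∈E_ G e F)
    e ∈E? F = map′ find (λ (f , f∈ , s) → lose f∈ s) (any? (sameEdge? e) (edges F))

    dominating⇒dominates : ∀ F → IsEdgeDominating G F → Dominates F
    dominating⇒dominates F dom e e-edge with e ∈E? F
    ... | yes (f , f∈ , s) = f , f∈ , sameEdge⇒share s
    ... | no  e∉F          = dom e e-edge e∉F

    different? : ∀ p f → Dec (¬ SameEdge G f p)
    different? p f = ¬? (sameEdge? f p)

    _without_ : EdgeSet G → V × V → EdgeSet G
    F without p = edgeSet (filter (different? p) (edges F))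
                          (Allₚ.filter⁺ (different? p) (areEdges F))
                          (AllPairsₚ.filter⁺ (different? p) (distinct F))

    ∈-without⁺ : ∀ F {p f} → f ∈ edges F → ¬ SameEdge G f p → f ∈ edges (F without p)
    ∈-without⁺ F {p} = ∈-filter⁺ (different? p)

    ∈-without⁻ : ∀ F {p f} → f ∈ edges (F without p) → f ∈ edges F × ¬ SameEdge G f p
    ∈-without⁻ F {p} = ∈-filter⁻ (different? p) {xs = edges F}

    without-⊂ : ∀ F {p} → p ∈ edges F → _⊂E_ G (F without p) F
    without-⊂ F {p} p∈ =
      (λ e (f , f∈ , s) → f , proj₁ (∈-without⁻ F f∈) , s) ,
      p , ∈⇒∈E F p∈ , λ (f , f∈ , s) → proj₂ (∈-without⁻ F f∈) (sameEdge-sym s)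

    minimal⇒without-¬dominating : ∀ F {p} → IsMinimalEdgeDominating G F → p ∈ edges F →
      ¬ IsEdgeDominating G (F without p)
    minimal⇒without-¬dominating F {p} (_ , minimal) p∈ = minimal (F without p) (without-⊂ F p∈)

    isolated⇒∈E : ∀ D D' {e} → _⊆E_ G D' D → IsEdgeDominating G D' → e ∈ edges D →
      (∀ {d} → d ∈ edges D → ShareEndpoint G e d → SameEdge G d e) → _∈E_ G e D'
    isolated⇒∈E D D' {e} D'⊆D dom e∈ isolated with e ∈E? D'
    ... | yes e∈D' = e∈D'
    ... | no  e∉D' =
      let d' , d'∈ , share = dom e (All.lookup (areEdges D) e∈) e∉D'
          d  , d∈  , d'~d  = D'⊆D d' (∈⇒∈E D' d'∈)
      in  d' , d'∈ , sameEdge-sym (sameEdge-trans d'~d (isolated d∈ (share-respʳ d'~d share)))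

record _≅_ {X Y : Set} (K : Graph X) (L : Graph Y) : Set where
  field
    to       : X → Y
    from     : Y → X
    from∘to  : ∀ x → from (to x) ≡ x
    to∘from  : ∀ y → to (from y) ≡ y
    to-adj   : ∀ {x y} → Adj K x y → Adj L (to x) (to y)
    from-adj : ∀ {x y} → Adj L x y → Adj K (from x) (from y)

≅-sym : ∀ {X Y} {K : Graph X} {L : Graph Y} → K ≅ L → L ≅ K
≅-sym φ = record
  { to = from ; from = to ; from∘to = to∘from ; to∘from = from∘to
  ; to-adj = from-adj ; from-adj = to-adj }
  where open _≅_ φ

□-comm : ∀ {A B} (G : Graph A) (H : Graph B) → (G □ H) ≅ (H □ G)
□-comm G H = record
  { to = swap ; from = swap ; from∘to = λ _ → refl ; to∘from = λ _ → refl
  ; to-adj = Sum.swap ; from-adj = Sum.swap }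

module EdgeTransport {X Y : Set} {K : Graph X} {L : Graph Y} (φ : K ≅ L) where
  open _≅_ φ

  toEdge : X × X → Y × Y
  toEdge (u , v) = to u , to v

  fromEdge : Y × Y → X × X
  fromEdge (u , v) = from u , from v

  fromEdge∘toEdge : ∀ e → fromEdge (toEdge e) ≡ e
  fromEdge∘toEdge (u , v) = cong₂ _,_ (from∘to u) (from∘to v)

  toEdge∘fromEdge : ∀ e → toEdge (fromEdge e) ≡ e
  toEdge∘fromEdge (u , v) = cong₂ _,_ (to∘from u) (to∘from v)

  toEdge-sameEdge : ∀ {e f} → SameEdge K e f → SameEdge L (toEdge e) (toEdge f)
  toEdge-sameEdge (inj₁ (refl , refl)) = inj₁ (refl , refl)
  toEdge-sameEdge (inj₂ (refl , refl)) = inj₂ (refl , refl)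

  fromEdge-sameEdge : ∀ {e f} → SameEdge L e f → SameEdge K (fromEdge e) (fromEdge f)
  fromEdge-sameEdge (inj₁ (refl , refl)) = inj₁ (refl , refl)
  fromEdge-sameEdge (inj₂ (refl , refl)) = inj₂ (refl , refl)

  toEdge-sameEdge⁻ : ∀ {e f} → SameEdge L (toEdge e) (toEdge f) → SameEdge K e f
  toEdge-sameEdge⁻ {e} {f} s =
    subst₂ (SameEdge K) (fromEdge∘toEdge e) (fromEdge∘toEdge f) (fromEdge-sameEdge s)

  toEdge-share : ∀ {e f} → ShareEndpoint K e f → ShareEndpoint L (toEdge e) (toEdge f)
  toEdge-share (inj₁ (inj₁ refl)) = inj₁ (inj₁ refl)
  toEdge-share (inj₁ (inj₂ refl)) = inj₁ (inj₂ refl)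
  toEdge-share (inj₂ (inj₁ refl)) = inj₂ (inj₁ refl)
  toEdge-share (inj₂ (inj₂ refl)) = inj₂ (inj₂ refl)

  mapEdgeSet : EdgeSet K → EdgeSet L
  mapEdgeSet F = edgeSet (map toEdge (edges F))
    (Allₚ.map⁺ (All.map to-adj (areEdges F)))
    (AllPairsₚ.map⁺ (AllPairs.map (λ e≁f → e≁f ∘ toEdge-sameEdge⁻) (distinct F)))

  ∈E-mapEdgeSet⁻ : ∀ {e} F → _∈E_ L e (mapEdgeSet F) → _∈E_ K (fromEdge e) F
  ∈E-mapEdgeSet⁻ {e} F (f' , f'∈ , s) with ∈-map⁻ toEdge f'∈
  ... | f , f∈ , refl =
    f , f∈ , subst (SameEdge K (fromEdge e)) (fromEdge∘toEdge f) (fromEdge-sameEdge s)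

  ∈E-mapEdgeSet⁺ : ∀ {e} F → _∈E_ K (fromEdge e) F → _∈E_ L e (mapEdgeSet F)
  ∈E-mapEdgeSet⁺ {e} F (f , f∈ , s) =
    toEdge f , ∈-map⁺ toEdge f∈ ,
    subst (λ e' → SameEdge L e' (toEdge f)) (toEdge∘fromEdge e) (toEdge-sameEdge s)

  mapEdgeSet-dominating : ∀ F → IsEdgeDominating K F → IsEdgeDominating L (mapEdgeSet F)
  mapEdgeSet-dominating F dom e e-edge e∉ =
    let f , f∈ , share = dom (fromEdge e) (from-adj e-edge) (e∉ ∘ ∈E-mapEdgeSet⁺ F)
    in  toEdge f , ∈-map⁺ toEdge f∈ ,
        subst (λ e' → ShareEndpoint L e' (toEdge f)) (toEdge∘fromEdge e) (toEdge-share share)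

  length-mapEdgeSet : ∀ F → length (edges (mapEdgeSet F)) ≡ length (edges F)
  length-mapEdgeSet F = length-map toEdge (edges F)

open EdgeTransport using (mapEdgeSet; length-mapEdgeSet)

minimal-≅ : ∀ {X Y} {K : Graph X} {L : Graph Y} (φ : K ≅ L) (F : EdgeSet K) →
  IsMinimalEdgeDominating K F → IsMinimalEdgeDominating L (mapEdgeSet φ F)
minimal-≅ {K = K} {L} φ F (dom , minimal) =
  mapEdgeSet-dominating F dom ,
  λ F' F'⊂ dom' → minimal (mapEdgeSet ψ F') (pullback-⊂ F' F'⊂) (ψ.mapEdgeSet-dominating F' dom')
  where
  open EdgeTransport φ hiding (mapEdgeSet; length-mapEdgeSet)
  ψ = ≅-sym φ
  module ψ = EdgeTransport ψ

  pullback-⊂ : ∀ F' → _⊂E_ L F' (mapEdgeSet φ F) → _⊂E_ K (mapEdgeSet ψ F') F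
  pullback-⊂ F' (F'⊆ , e , e∈ , e∉F') = pullback-⊆ , fromEdge e , ∈E-mapEdgeSet⁻ F e∈ , e∉
    where
    pullback-⊆ : _⊆E_ K (mapEdgeSet ψ F') F
    pullback-⊆ x x∈ = subst (λ x' → _∈E_ K x' F) (fromEdge∘toEdge x)
                        (∈E-mapEdgeSet⁻ F (F'⊆ (toEdge x) (ψ.∈E-mapEdgeSet⁻ F' x∈)))

    e∉ : ¬ _∈E_ K (fromEdge e) (mapEdgeSet ψ F')
    e∉ e∈ψF' =
      e∉F' (subst (λ e' → _∈E_ L e' F') (toEdge∘fromEdge e) (ψ.∈E-mapEdgeSet⁻ F' e∈ψF'))

wellEdgeDominated-≅ : ∀ {X Y} {K : Graph X} {L : Graph Y} → K ≅ L →
  WellEdgeDominated L → WellEdgeDominated K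
wellEdgeDominated-≅ φ wed F F' minF minF' = begin
  length (edges F)                 ≡⟨ sym (length-mapEdgeSet φ F) ⟩
  length (edges (mapEdgeSet φ F))  ≡⟨ wed (mapEdgeSet φ F) (mapEdgeSet φ F')
                                          (minimal-≅ φ F minF) (minimal-≅ φ F' minF') ⟩
  length (edges (mapEdgeSet φ F')) ≡⟨ length-mapEdgeSet φ F' ⟩
  length (edges F')                ∎
  where open ≡-Reasoning

module Matchings {n : ℕ} (H : Graph (Fin n)) where

  VertexDisjoint : Fin n × Fin n → Fin n × Fin n → Set
  VertexDisjoint e f = ∀ w → Incident H w e → ¬ Incident H w f

  record Matching : Set where
    constructor matching
    field
      matchedEdges : List (Fin n × Fin n)
      areEdges     : All (IsEdge H) matchedEdges
      disjoint     : AllPairs VertexDisjoint matchedEdges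
  open Matching public

  Covers : Matching → Fin n → Set
  Covers M w = ∃ λ e → e ∈ matchedEdges M × Incident H w e

  IsMaximal : Matching → Set
  IsMaximal M = ∀ {u v} → Adj H u v → Covers M u ⊎ Covers M v

  vertexDisjoint⇒¬sameEdge : ∀ {e f} → VertexDisjoint e f → ¬ SameEdge H e f
  vertexDisjoint⇒¬sameEdge d (inj₁ (refl , refl)) = d _ (inj₁ refl) (inj₁ refl)
  vertexDisjoint⇒¬sameEdge d (inj₂ (refl , refl)) = d _ (inj₁ refl) (inj₂ refl)

  toEdgeSet : Matching → EdgeSet H
  toEdgeSet M = edgeSet (matchedEdges M) (areEdges M)
                        (AllPairs.map vertexDisjoint⇒¬sameEdge (disjoint M))

  matched-incident-unique : ∀ M {p q w} → p ∈ matchedEdges M → q ∈ matchedEdges M →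
    Incident H w p → Incident H w q → p ≡ q
  matched-incident-unique M = go (disjoint M)
    where
    go : ∀ {es p q w} → AllPairs VertexDisjoint es → p ∈ es → q ∈ es →
      Incident H w p → Incident H w q → p ≡ q
    go (_  ∷ _)  (here refl) (here refl) _  _  = refl
    go (p≁ ∷ _)  (here refl) (there q∈)  ip iq = ⊥-elim (All.lookup p≁ q∈ _ ip iq)
    go (q≁ ∷ _)  (there p∈)  (here refl) ip iq = ⊥-elim (All.lookup q≁ p∈ _ iq ip)
    go (_  ∷ ds) (there p∈)  (there q∈)  ip iq = go ds p∈ q∈ ip iq

  covers? : ∀ M w → Dec (Covers M w)
  covers? M w = map′ find (λ (e , e∈ , i) → lose e∈ i) (any? incident? (matchedEdges M))
    where
    incident? : ∀ e → Dec (Incident H w e)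
    incident? (u , v) = (w ≟ᶠ u) ⊎-dec (w ≟ᶠ v)

  unmatched : Matching → List (Fin n)
  unmatched M = filter (λ w → ¬? (covers? M w)) (allFin n)

  ∈-unmatched⁺ : ∀ M {w} → ¬ Covers M w → w ∈ unmatched M
  ∈-unmatched⁺ M {w} = ∈-filter⁺ (λ w → ¬? (covers? M w)) (∈-allFin w)

  ∈-unmatched⁻ : ∀ M {w} → w ∈ unmatched M → ¬ Covers M w
  ∈-unmatched⁻ M = proj₂ ∘ ∈-filter⁻ (λ w → ¬? (covers? M w)) {xs = allFin n}

  unmatched-unique : ∀ M → Unique (unmatched M)
  unmatched-unique M = Uniqueₚ.filter⁺ (λ w → ¬? (covers? M w)) (Uniqueₚ.allFin⁺ n)

  unmatched-nonZero : ∀ M → ¬ HasPerfectMatching H → NonZero (length (unmatched M))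
  unmatched-nonZero M noPM = nonEmpty (unmatched M) (∈-unmatched⁺ M)
    where
    nonEmpty : ∀ ws → (∀ {w} → ¬ Covers M w → w ∈ ws) → NonZero (length ws)
    nonEmpty (_ ∷ _) _        = _
    nonEmpty []      complete = ⊥-elim (noPM (toEdgeSet M , disjoint M , covered))
      where
      covered : ∀ w → Covers M w
      covered w = decidable-stable (covers? M w) (λ uncovered → case complete uncovered of λ ())

  module Greedy (adj? : Decidable (Adj H)) where

    insert : ∀ M {u v} → Adj H u v → ¬ Covers M u → ¬ Covers M v → Matching
    insert M {u} {v} uv ¬cu ¬cv = matching ((u , v) ∷ matchedEdges M) (uv ∷ areEdges M)
      (All.tabulate (λ f∈ → λ { _ (inj₁ refl) i → ¬cu (_ , f∈ , i)
                             ; _ (inj₂ refl) i → ¬cv (_ , f∈ , i) })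
       ∷ disjoint M)

    greedyStep : Matching → Fin n × Fin n → Matching
    greedyStep M (u , v) with adj? u v | covers? M u | covers? M v
    ... | yes uv | no ¬cu | no ¬cv = insert M uv ¬cu ¬cv
    ... | _      | _      | _      = M

    greedyStep-covers : ∀ M e {w} → Covers M w → Covers (greedyStep M e) w
    greedyStep-covers M (u , v) c with adj? u v | covers? M u | covers? M v
    ... | yes _ | no _  | no _  = let f , f∈ , i = c in f , there f∈ , i
    ... | yes _ | yes _ | _     = c
    ... | yes _ | no _  | yes _ = c
    ... | no _  | _     | _     = c

    greedyStep-covers-edge : ∀ M {u v} → Adj H u v →
      Covers (greedyStep M (u , v)) u ⊎ Covers (greedyStep M (u , v)) v
    greedyStep-covers-edge M {u} {v} uv with adj? u v | covers? M u | covers? M v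
    ... | yes _  | no _  | no _  = inj₁ (_ , here refl , inj₁ refl)
    ... | yes _  | yes c | _     = inj₁ c
    ... | yes _  | no _  | yes c = inj₂ c
    ... | no ¬uv | _     | _     = ⊥-elim (¬uv uv)

    foldl-covers : ∀ M es {w} → Covers M w → Covers (foldl greedyStep M es) w
    foldl-covers M []       c = c
    foldl-covers M (e ∷ es) c = foldl-covers (greedyStep M e) es (greedyStep-covers M e c)

    foldl-covers-edge : ∀ M es {u v} → (u , v) ∈ es → Adj H u v →
      Covers (foldl greedyStep M es) u ⊎ Covers (foldl greedyStep M es) v
    foldl-covers-edge M (e ∷ es) (here refl) uv =
      Sum.map (foldl-covers _ es) (foldl-covers _ es) (greedyStep-covers-edge M uv)
    foldl-covers-edge M (e ∷ es) (there e∈) uv = foldl-covers-edge (greedyStep M e) es e∈ uv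

    maximalMatching : Matching
    maximalMatching =
      foldl greedyStep (matching [] [] []) (cartesianProduct (allFin n) (allFin n))

    maximalMatching-isMaximal : IsMaximal maximalMatching
    maximalMatching-isMaximal {u} {v} =
      foldl-covers-edge _ _ (∈-cartesianProduct⁺ (∈-allFin u) (∈-allFin v))

module FibresAndLayers {m n : ℕ} (G : Graph (Fin m)) (H : Graph (Fin n)) where

  private
    P : Graph (Fin m × Fin n)
    P = G □ H

    Edgeᴾ : Set
    Edgeᴾ = (Fin m × Fin n) × (Fin m × Fin n)

    module Gₑ = EdgeProperties G
    module Gᵈ = Gₑ.DecidableVertices _≟ᶠ_
    module Pₑ = EdgeProperties P
    module Pᵈ = Pₑ.DecidableVertices (≡-dec _≟ᶠ_ _≟ᶠ_)

  open Matchings H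

  fibreEdge : Fin m → Fin n × Fin n → Edgeᴾ
  fibreEdge g (a , b) = (g , a) , (g , b)

  layerEdge : Fin n → Fin m × Fin m → Edgeᴾ
  layerEdge h (u , v) = (u , h) , (v , h)

  incident-fibre⁺ : ∀ {g w p} → Incident H w p → Incident P (g , w) (fibreEdge g p)
  incident-fibre⁺ (inj₁ refl) = inj₁ refl
  incident-fibre⁺ (inj₂ refl) = inj₂ refl

  incident-fibre⁻ : ∀ {x w g p} → Incident P (x , w) (fibreEdge g p) → x ≡ g × Incident H w p
  incident-fibre⁻ (inj₁ refl) = refl , inj₁ refl
  incident-fibre⁻ (inj₂ refl) = refl , inj₂ refl

  incident-layer⁻ : ∀ {x w h q} → Incident P (x , w) (layerEdge h q) → w ≡ h × Incident G x q
  incident-layer⁻ (inj₁ refl) = refl , inj₁ refl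
  incident-layer⁻ (inj₂ refl) = refl , inj₂ refl

  share-fibre-fibre : ∀ {g g' p q} → ShareEndpoint P (fibreEdge g p) (fibreEdge g' q) →
    g ≡ g' × ∃ λ w → Incident H w p × Incident H w q
  share-fibre-fibre (inj₁ i) = Product.map₂ (λ iq → _ , inj₁ refl , iq) (incident-fibre⁻ i)
  share-fibre-fibre (inj₂ i) = Product.map₂ (λ iq → _ , inj₂ refl , iq) (incident-fibre⁻ i)

  share-fibre-layer : ∀ {g h p q} → ShareEndpoint P (fibreEdge g p) (layerEdge h q) →
    Incident H h p
  share-fibre-layer (inj₁ i) = inj₁ (sym (proj₁ (incident-layer⁻ i)))
  share-fibre-layer (inj₂ i) = inj₂ (sym (proj₁ (incident-layer⁻ i)))

  share-layer-fibre : ∀ {g h e p} → ShareEndpoint P (layerEdge h e) (fibreEdge g p) →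
    Incident H h p
  share-layer-fibre (inj₁ i) = proj₂ (incident-fibre⁻ i)
  share-layer-fibre (inj₂ i) = proj₂ (incident-fibre⁻ i)

  share-layer-layer : ∀ {h h' e q} → ShareEndpoint P (layerEdge h e) (layerEdge h' q) →
    h ≡ h' × ShareEndpoint G e q
  share-layer-layer (inj₁ i) = Product.map₂ inj₁ (incident-layer⁻ i)
  share-layer-layer (inj₂ i) = Product.map₂ inj₂ (incident-layer⁻ i)

  share-layer⁺ : ∀ {h e q} → ShareEndpoint G e q →
    ShareEndpoint P (layerEdge h e) (layerEdge h q)
  share-layer⁺ (inj₁ (inj₁ refl)) = inj₁ (inj₁ refl)
  share-layer⁺ (inj₁ (inj₂ refl)) = inj₁ (inj₂ refl)
  share-layer⁺ (inj₂ (inj₁ refl)) = inj₂ (inj₁ refl)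
  share-layer⁺ (inj₂ (inj₂ refl)) = inj₂ (inj₂ refl)

  sameEdge-fibre⁻ : ∀ {g g' p q} → SameEdge P (fibreEdge g p) (fibreEdge g' q) →
    g ≡ g' × SameEdge H p q
  sameEdge-fibre⁻ (inj₁ (refl , refl)) = refl , inj₁ (refl , refl)
  sameEdge-fibre⁻ (inj₂ (refl , refl)) = refl , inj₂ (refl , refl)

  sameEdge-layer⁻ : ∀ {h h' p q} → SameEdge P (layerEdge h p) (layerEdge h' q) →
    h ≡ h' × SameEdge G p q
  sameEdge-layer⁻ (inj₁ (refl , refl)) = refl , inj₁ (refl , refl)
  sameEdge-layer⁻ (inj₂ (refl , refl)) = refl , inj₂ (refl , refl)

  sameEdge-layer⁺ : ∀ {h p q} → SameEdge G p q → SameEdge P (layerEdge h p) (layerEdge h q)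
  sameEdge-layer⁺ (inj₁ (refl , refl)) = inj₁ (refl , refl)
  sameEdge-layer⁺ (inj₂ (refl , refl)) = inj₂ (refl , refl)

  module Expansion (M : Matching) (maximal : IsMaximal M) where

    fibreEdges : List Edgeᴾ
    fibreEdges = cartesianProductWith fibreEdge (allFin m) (matchedEdges M)

    layerEdges : EdgeSet G → List Edgeᴾ
    layerEdges F = cartesianProductWith layerEdge (unmatched M) (edges F)

    data ExpansionView (F : EdgeSet G) : Edgeᴾ → Set where
      fibre : ∀ g {p} → p ∈ matchedEdges M → ExpansionView F (fibreEdge g p)
      layer : ∀ {h q} → h ∈ unmatched M → q ∈ edges F → ExpansionView F (layerEdge h q)

    view : ∀ F {d} → d ∈ fibreEdges ++ layerEdges F → ExpansionView F d
    view F d∈ with ∈-++⁻ fibreEdges d∈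
    ... | inj₁ d∈f with ∈-cartesianProductWith⁻ fibreEdge (allFin m) (matchedEdges M) d∈f
    ...   | g , _ , _ , p∈ , refl = fibre g p∈
    view F d∈ | inj₂ d∈l with ∈-cartesianProductWith⁻ layerEdge (unmatched M) (edges F) d∈l
    ...   | _ , _ , h∈ , q∈ , refl = layer h∈ q∈

    fibreEdges-unique : UniqueSetoid.Unique Pₑ.edgeSetoid fibreEdges
    fibreEdges-unique =
      UniqueSetoidₚ.cartesianProductWith⁺ (setoid (Fin m)) (EdgeProperties.edgeSetoid H)
        Pₑ.edgeSetoid fibreEdge sameEdge-fibre⁻ (Uniqueₚ.allFin⁺ m) (distinct (toEdgeSet M))

    layerEdges-unique : ∀ F → UniqueSetoid.Unique Pₑ.edgeSetoid (layerEdges F)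
    layerEdges-unique F =
      UniqueSetoidₚ.cartesianProductWith⁺ (setoid (Fin n)) Gₑ.edgeSetoid
        Pₑ.edgeSetoid layerEdge sameEdge-layer⁻ (unmatched-unique M) (distinct F)

    fibreEdges-disjoint-layerEdges : ∀ F → Disjoint Pₑ.edgeSetoid fibreEdges (layerEdges F)
    fibreEdges-disjoint-layerEdges F (v∈f , v∈l) with find v∈f | find v∈l
    ... | _ , d∈f , v~d | _ , d'∈l , v~d'
        with ∈-cartesianProductWith⁻ fibreEdge (allFin m) (matchedEdges M) d∈f
           | ∈-cartesianProductWith⁻ layerEdge (unmatched M) (edges F) d'∈l
    ... | _ , _ , _ , p∈ , refl | _ , _ , h∈ , _ , refl =
      ∈-unmatched⁻ M h∈ (_ , p∈ ,
        share-fibre-layer (Pₑ.sameEdge⇒share (Pₑ.sameEdge-trans (Pₑ.sameEdge-sym v~d) v~d')))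

    expand : EdgeSet G → EdgeSet P
    expand F = edgeSet (fibreEdges ++ layerEdges F) (All.tabulate (isEdge ∘ view F))
      (UniqueSetoidₚ.++⁺ Pₑ.edgeSetoid fibreEdges-unique (layerEdges-unique F)
        (fibreEdges-disjoint-layerEdges F))
      where
      isEdge : ∀ {d} → ExpansionView F d → IsEdge P d
      isEdge (fibre _ p∈) = inj₁ (refl , All.lookup (areEdges M) p∈)
      isEdge (layer _ q∈) = inj₂ (refl , All.lookup (areEdges F) q∈)

    fibreEdge-∈-expand : ∀ F g {p} → p ∈ matchedEdges M → fibreEdge g p ∈ edges (expand F)
    fibreEdge-∈-expand F g p∈ = ∈-++⁺ˡ (∈-cartesianProductWith⁺ fibreEdge (∈-allFin g) p∈)

    layerEdge-∈-expand : ∀ F {h q} → h ∈ unmatched M → q ∈ edges F →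
      layerEdge h q ∈ edges (expand F)
    layerEdge-∈-expand F h∈ q∈ = ∈-++⁺ʳ fibreEdges (∈-cartesianProductWith⁺ layerEdge h∈ q∈)

    length-expand : ∀ F → length (edges (expand F)) ≡
      m * length (matchedEdges M) + length (unmatched M) * length (edges F)
    length-expand F = begin
      length (fibreEdges ++ layerEdges F)
        ≡⟨ length-++ fibreEdges ⟩
      length fibreEdges + length (layerEdges F)
        ≡⟨ cong₂ _+_ (length-cartesianProductWith fibreEdge (allFin m) (matchedEdges M))
                     (length-cartesianProductWith layerEdge (unmatched M) (edges F)) ⟩
      length (allFin m) * |M| + length (unmatched M) * length (edges F)
        ≡⟨ cong (λ k → k * |M| + length (unmatched M) * length (edges F))
                (length-tabulate {n = m} id) ⟩
      m * |M| + length (unmatched M) * length (edges F)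
        ∎
      where
      open ≡-Reasoning
      |M| = length (matchedEdges M)

    expand-dominates : ∀ F → Gₑ.Dominates F → Pₑ.Dominates (expand F)
    expand-dominates F dom ((g , _) , (_ , _)) (inj₁ (refl , ab)) with maximal ab
    ... | inj₁ (p , p∈ , i) = fibreEdge g p , fibreEdge-∈-expand F g p∈ , inj₁ (incident-fibre⁺ i)
    ... | inj₂ (p , p∈ , i) = fibreEdge g p , fibreEdge-∈-expand F g p∈ , inj₂ (incident-fibre⁺ i)
    expand-dominates F dom ((u , h) , (v , _)) (inj₂ (refl , uv)) with covers? M h
    ... | yes (p , p∈ , i) = fibreEdge u p , fibreEdge-∈-expand F u p∈ , inj₁ (incident-fibre⁺ i)
    ... | no ¬covered =
      let q , q∈ , share = dom (u , v) uv
      in  layerEdge h q , layerEdge-∈-expand F (∈-unmatched⁺ M ¬covered) q∈ , share-layer⁺ share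

    fibreEdge-isolated : ∀ F {g p d} → p ∈ matchedEdges M → d ∈ edges (expand F) →
      ShareEndpoint P (fibreEdge g p) d → SameEdge P d (fibreEdge g p)
    fibreEdge-isolated F p∈ d∈ share with view F d∈
    ... | fibre _ q∈ with share-fibre-fibre share
    ...   | refl , _ , ip , iq rewrite matched-incident-unique M p∈ q∈ ip iq = Pₑ.sameEdge-refl
    fibreEdge-isolated F p∈ d∈ share | layer h∈ _ =
      ⊥-elim (∈-unmatched⁻ M h∈ (_ , p∈ , share-fibre-layer share))

    -- Over an unmatched h the only edges of the expansion meeting the layer G × {h} are the
    -- copies of F, so a dominating D ⊆ expand F restricts to a dominating subset of F.
    without-dominates : ∀ F D {h q} → _⊆E_ P D (expand F) → Pₑ.Dominates D →
      h ∈ unmatched M → ¬ _∈E_ P (layerEdge h q) D → Gₑ.Dominates (F Gᵈ.without q)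
    without-dominates F D {h} {q} D⊆ dom h∈ hq∉D e e-edge
      with dom (layerEdge h e) (inj₂ (refl , e-edge))
    ... | d' , d'∈ , share with D⊆ d' (Pₑ.∈⇒∈E D d'∈)
    ... | d , d∈ , d'~d with view F d∈ | Pₑ.share-respʳ d'~d share
    ... | fibre _ p∈ | share' = ⊥-elim (∈-unmatched⁻ M h∈ (_ , p∈ , share-layer-fibre share'))
    ... | layer {q = q'} _ q'∈ | share' with share-layer-layer share' | Gᵈ.sameEdge? q' q
    ...   | refl , _ | yes q'~q =
      ⊥-elim (hq∉D (d' , d'∈ , Pₑ.sameEdge-sym (Pₑ.sameEdge-trans d'~d (sameEdge-layer⁺ q'~q))))
    ...   | refl , eq' | no q'≁q = q' , Gᵈ.∈-without⁺ F q'∈ q'≁q , eq'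

    expand-minimal : ∀ F → IsMinimalEdgeDominating G F → IsMinimalEdgeDominating P (expand F)
    expand-minimal F minF@(domF , _) =
      Pₑ.dominates⇒dominating (expand F) (expand-dominates F (Gᵈ.dominating⇒dominates F domF)) ,
      ¬proper
      where
      ¬proper : ∀ D → _⊂E_ P D (expand F) → ¬ IsEdgeDominating P D
      ¬proper D (D⊆ , e , (f , f∈ , e~f) , e∉D) domD with view F f∈
      ... | fibre _ p∈ =
        e∉D (Pₑ.∈E-resp D e~f
          (Pᵈ.isolated⇒∈E (expand F) D D⊆ domD f∈ (fibreEdge-isolated F p∈)))
      ... | layer {q = q} h∈ q∈ =
        Gᵈ.minimal⇒without-¬dominating F minF q∈
          (Gₑ.dominates⇒dominating (F Gᵈ.without q)
            (without-dominates F D D⊆ (Pᵈ.dominating⇒dominates D domD) h∈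
              (e∉D ∘ Pₑ.∈E-resp D e~f)))

    wellEdgeDominated : NonZero (length (unmatched M)) →
      WellEdgeDominated (G □ H) → WellEdgeDominated G
    wellEdgeDominated |U|≢0 wed F F' minF minF' =
      *-cancelˡ-≡ (length (edges F)) (length (edges F')) |U| {{|U|≢0}}
        (+-cancelˡ-≡ (m * |M|) _ _ (begin
          m * |M| + |U| * length (edges F)   ≡⟨ sym (length-expand F) ⟩
          length (edges (expand F))          ≡⟨ wed (expand F) (expand F')
                                                    (expand-minimal F minF) (expand-minimal F' minF') ⟩
          length (edges (expand F'))         ≡⟨ length-expand F' ⟩
          m * |M| + |U| * length (edges F')  ∎))
      where
      open ≡-Reasoning
      |M| = length (matchedEdges M)
      |U| = length (unmatched M)

¬¬-decidable : ∀ {n} (R : Fin n → Fin n → Set) → ¬ ¬ (∀ u v → Dec (R u v))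
¬¬-decidable R =
  sequence ¬¬-applicative λ u → sequence ¬¬-applicative λ v → ¬¬-excluded-middle
  where ¬¬-applicative = RawMonad.rawApplicative ¬¬-Monad

-- Adjacency in H need not be decidable, but the goal is an equation of naturals, which is
-- stable under double negation, so decidability of adjacency may be assumed.
wellEdgeDominated-□ˡ : ∀ {m n} (G : Graph (Fin m)) (H : Graph (Fin n)) →
  ¬ HasPerfectMatching H → WellEdgeDominated (G □ H) → WellEdgeDominated G
wellEdgeDominated-□ˡ G H noPM wed F F' minF minF' =
  decidable-stable (length (edges F) ≟ℕ length (edges F')) λ ≢ →
    ¬¬-decidable (Adj H) λ adj? → ≢ (viaMaximalMatching adj? F F' minF minF')
  where
  open Matchings H

  viaMaximalMatching : Decidable (Adj H) → WellEdgeDominated G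
  viaMaximalMatching adj? = Expansion.wellEdgeDominated M M-isMaximal (unmatched-nonZero M noPM) wed
    where
    open FibresAndLayers G H
    open Greedy adj? renaming (maximalMatching to M; maximalMatching-isMaximal to M-isMaximal)

proposition15 : ∀ (m n : ℕ) (G : Graph (Fin m)) (H : Graph (Fin n)) →
    m ≥ 2 → n ≥ 2 → Connected G → Connected H →
    ¬ HasPerfectMatching G → ¬ HasPerfectMatching H →
    WellEdgeDominated (G □ H) → WellEdgeDominated G × WellEdgeDominated H
proposition15 m n G H _ _ _ _ noPM-G noPM-H wed =
  wellEdgeDominated-□ˡ G H noPM-H wed ,
  wellEdgeDominated-□ˡ H G noPM-G (wellEdgeDominated-≅ (□-comm H G) wed)
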